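{- Let $\mathcal{T}$ be a $\mathcal{TEL}^{\bigcirc}_{\mathit{lin}}$-TBox and $\mathcal{T}^{\,\mathit{lin}}_{\mathit{rig}}$ as in the context. For any concept names $A,B$ occurring in $\mathcal{T}$ and any $n\in\mathbb{Z}$: $\mathcal{T}\models A\sqsubseteq\bigcirc^nB$ if and only if $\mathcal{T}^{\,\mathit{lin}}_{\mathit{rig}}\models A\sqsubseteq\bigcirc^nB$.
   Context: A $\mathcal{TEL}^{\bigcirc}_{\mathit{lin}}$-TBox is a finite set of concept inclusions $A\sqsubseteq\bigcirc^nB$, $\exists r.A\sqsubseteq B$, $A\sqsubseteq\exists r.B$ ($A,B$ concept names, $r$ a role name which is either rigid or local, $n\in\mathbb{Z}$, $\bigcirc^0B=B$). Semantics: an interpretation is a family $(\mathcal{I}_i)_{i\in\mathbb{Z}}$ of classical DL interpretations over a common domain, rigid role names interpreted identically at all $i$; $(\bigcirc^nA)^{i}=A^{i+n}$, $(\exists r.A)^i=\{d\mid\exists e\in A^i,(d,e)\in r^i\}$; $C\sqsubseteq D$ holds if $C^i\subseteq D^i$ for all $i$; $\models$ is entailment. Let $\mathcal{T}_0$ be obtained from $\mathcal{T}$ by removing all concept inclusions that use local role names, and $\mathcal{T}^{\,\mathit{lin}}_{\mathit{rig}}=\mathcal{T}_0\cup\{A\sqsubseteq B\mid A,B\text{ concept names},\ \mathcal{T}\models A\sqsubseteq B\}$. -}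

module Defs where

open import Level using (Level; _⊔_) renaming (suc to lsuc; zero to lzero)
open import Data.Nat using (ℕ)
open import Data.Integer using (ℤ; _+_; 0ℤ)
open import Data.Product using (Σ; ∃; _×_; _,_)
open import Data.Sum using (_⊎_)
open import Data.List using (List)
open import Data.List.Membership.Propositional using (_∈_)
open import Data.List.Relation.Unary.Any using (Any)
open import Relation.Binary.PropositionalEquality using (_≡_)
open import Data.Empty using (⊥)
open import Data.Unit using (⊤)

ConceptName : Set
ConceptName = ℕ

data RoleName : Set where
  rigid : ℕ → RoleName
  local : ℕ → RoleName

data CI : Set where
  _⊑○[_]_ : ConceptName → ℤ → ConceptName → CI
  ∃[_]_⊑_ : RoleName → ConceptName → ConceptName → CI
  _⊑∃[_]_ : ConceptName → RoleName → ConceptName → CI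

TBox : Set
TBox = List CI

record Interp : Set₁ where
  field
    Δ     : Set
    point : Δ                                  -- domain is non-empty
    conc  : ConceptName → ℤ → Δ → Set
    rigᴵ  : ℕ → Δ → Δ → Set
    locᴵ  : ℕ → ℤ → Δ → Δ → Set

open Interp public

roleᴵ : (I : Interp) → RoleName → ℤ → Δ I → Δ I → Set
roleᴵ I (rigid r) i d e = rigᴵ I r d e
roleᴵ I (local r) i d e = locᴵ I r i d e

_⊨ᶜ_ : Interp → CI → Set
I ⊨ᶜ (A ⊑○[ n ] B) = ∀ (i : ℤ) (d : Δ I) → conc I A i d → conc I B (i + n) d
I ⊨ᶜ (∃[ r ] A ⊑ B) = ∀ (i : ℤ) (d e : Δ I) → roleᴵ I r i d e → conc I A i e → conc I B i d
I ⊨ᶜ (A ⊑∃[ r ] B) = ∀ (i : ℤ) (d : Δ I) → conc I A i d → ∃ λ e → roleᴵ I r i d e × conc I B i e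

-- Sets of concept inclusions given as predicates (needed since T^lin_rig
-- is defined via entailment).
CISet : (ℓ : Level) → Set (lsuc ℓ)
CISet ℓ = CI → Set ℓ

Model : ∀ {ℓ} → Interp → CISet ℓ → Set ℓ
Model I S = ∀ α → S α → I ⊨ᶜ α

_⊨_ : ∀ {ℓ} → CISet ℓ → CI → Set (lsuc lzero ⊔ ℓ)
S ⊨ α = ∀ (I : Interp) → Model I S → I ⊨ᶜ α

⟦_⟧ : TBox → CISet lzero
⟦ T ⟧ α = α ∈ T

UsesLocal : CI → Set
UsesLocal (A ⊑○[ n ] B) = ⊥
UsesLocal (∃[ rigid r ] A ⊑ B) = ⊥
UsesLocal (∃[ local r ] A ⊑ B) = ⊤
UsesLocal (A ⊑∃[ rigid r ] B) = ⊥
UsesLocal (A ⊑∃[ local r ] B) = ⊤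

T₀ : TBox → CISet lzero
T₀ T α = α ∈ T × (UsesLocal α → ⊥)

Tlinrig : TBox → CISet (lsuc lzero)
Tlinrig T α = Level.Lift (lsuc lzero) (T₀ T α)
            ⊎ (Σ ConceptName λ A → Σ ConceptName λ B →
                 (α ≡ (A ⊑○[ 0ℤ ] B)) × (⟦ T ⟧ ⊨ (A ⊑○[ 0ℤ ] B)))

OccursCI : ConceptName → CI → Set
OccursCI X (A ⊑○[ n ] B) = (X ≡ A) ⊎ (X ≡ B)
OccursCI X (∃[ r ] A ⊑ B) = (X ≡ A) ⊎ (X ≡ B)
OccursCI X (A ⊑∃[ r ] B) = (X ≡ A) ⊎ (X ≡ B)

OccursIn : ConceptName → TBox → Set
OccursIn X T = Any (OccursCI X) T

-- Every model of T is a model of T^lin_rig, which gives one direction.  Conversely, a model I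
-- of T^lin_rig extends to a model of T that leaves the concept memberships of I's elements
-- untouched.  Rigid existentials belong to T₀ and are satisfied inside I.  For a local
-- existential A ⊑ ∃r.B satisfied by d at time i, d gets a fresh tree of anonymous elements
-- rooted in B at time i, whose memberships are exactly those derivable from T (a chase).  The
-- only way such a tree acts back on d is through some ∃r.C ⊑ D of T, with C derived at the
-- root; since derivations are sound in every model of T, T ⊨ A ⊑ D, an inclusion of
-- T^lin_rig that I already satisfies.
module Submission where

open import Defs
open import Level using (Level; lift)
open import Data.Integer using (ℤ; _+_; -_; 0ℤ)
open import Data.Integer.Properties using (+-identityʳ; +-0-abelianGroup; +-commutativeSemigroup)
open import Algebra.Properties.AbelianGroup +-0-abelianGroup using (\\-leftDividesˡ)
open import Algebra.Properties.CommutativeSemigroup +-commutativeSemigroup using (xy∙z≈xz∙y)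
open import Data.Product using (Σ; _×_; _,_)
open import Data.Sum using (_⊎_; inj₁; inj₂)
open import Data.List using (List; []; _∷_)
open import Data.List.Membership.Propositional using (_∈_)
open import Data.Empty using (⊥)
open import Data.Unit using (⊤; tt)
open import Data.Nat using (ℕ)
open import Relation.Binary.PropositionalEquality using (_≡_; refl; sym; subst)
open import Function.Bundles using (_⇔_; mk⇔)

private
  variable
    ℓ ℓ′ : Level

⊨-antitone : {S : CISet ℓ} {S′ : CISet ℓ′} {α : CI} →
             (∀ I → Model I S′ → Model I S) → S ⊨ α → S′ ⊨ α
⊨-antitone models S⊨α I I⊨S′ = S⊨α I (models I I⊨S′)

record ConceptEmbedding (I J : Interp) : Set where
  field
    embed    : Δ I → Δ J
    preserve : ∀ {C i d} → conc I C i d → conc J C i (embed d)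
    reflect  : ∀ {C i d} → conc J C i (embed d) → conc I C i d

⊨○-reflect : {S : CISet ℓ} {S′ : CISet ℓ′} {A B : ConceptName} {n : ℤ} →
             (∀ I → Model I S′ → Σ Interp λ J → Model J S × ConceptEmbedding I J) →
             S ⊨ (A ⊑○[ n ] B) → S′ ⊨ (A ⊑○[ n ] B)
⊨○-reflect extend S⊨A⊑B I I⊨S′ i d d∈A with extend I I⊨S′
... | J , J⊨S , e = reflect (S⊨A⊑B J J⊨S i (embed d) (preserve d∈A))
  where open ConceptEmbedding e

Model⇒Model-Tlinrig : (T : TBox) (I : Interp) → Model I ⟦ T ⟧ → Model I (Tlinrig T)
Model⇒Model-Tlinrig T I I⊨T α (inj₁ (lift (α∈T , _)))   = I⊨T α α∈T
Model⇒Model-Tlinrig T I I⊨T α (inj₂ (_ , _ , refl , T⊨α)) = T⊨α I I⊨T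

-- An application of the existential X ⊑ ∃r.Y at time j.
data Step : Set where
  step : ConceptName → RoleName → ConceptName → ℤ → Step

-- Whether an r-edge created at time j is present at time k.
Persists : RoleName → ℤ → ℤ → Set
Persists (rigid _) j k = ⊤
Persists (local _) j k = k ≡ j

persists-role : ∀ (I : Interp) r {j k δ x y} → Persists r j k →
                roleᴵ I r (j + δ) x y → roleᴵ I r (k + δ) x y
persists-role I (rigid _) _    xry = xry
persists-role I (local _) refl xry = xry

module Chase (S : CISet ℓ) where

  -- Derivable B₀ i₀ w C k: the anonymous element reached from a fresh B₀-element at time i₀
  -- along the path w (last step first) belongs to C at time k.
  data Derivable (B₀ : ConceptName) (i₀ : ℤ) : List Step → ConceptName → ℤ → Set ℓ where
    root     : Derivable B₀ i₀ [] B₀ i₀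
    next     : ∀ {w X Y j m} → Derivable B₀ i₀ w X j → S (X ⊑○[ m ] Y) →
               Derivable B₀ i₀ w Y (j + m)
    witness  : ∀ {w X r Y j} → Derivable B₀ i₀ (step X r Y j ∷ w) Y j
    backward : ∀ {w X r Y j C D k} → Derivable B₀ i₀ w X j → S (X ⊑∃[ r ] Y) →
               Derivable B₀ i₀ (step X r Y j ∷ w) C k → S (∃[ r ] C ⊑ D) → Persists r j k →
               Derivable B₀ i₀ w D k

  module _ (K : Interp) (K⊨S : Model K S) (δ : ℤ) (B₀ : ConceptName) (i₀ : ℤ) where

    data Realises : List Step → Δ K → Set where
      root : ∀ {x} → conc K B₀ (i₀ + δ) x → Realises [] x
      step : ∀ {w x y X r Y j} → Realises w x → roleᴵ K r (j + δ) x y → conc K Y (j + δ) y →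
             Realises (step X r Y j ∷ w) y

    derivable-sound : ∀ {w C k x} → Derivable B₀ i₀ w C k → Realises w x → conc K C (k + δ) x
    derivable-sound root (root x∈B₀) = x∈B₀
    derivable-sound (next {j = j} {m} der X⊑Y) rx =
      subst (λ t → conc K _ t _) (xy∙z≈xz∙y j δ m) (K⊨S _ X⊑Y (j + δ) _ (derivable-sound der rx))
    derivable-sound witness (step _ _ y∈Y) = y∈Y
    derivable-sound (backward {r = r} {j = j} {k = k} der X⊑∃Y derʸ ∃C⊑D p) rx
      with K⊨S _ X⊑∃Y (j + δ) _ (derivable-sound der rx)
    ... | y , xry , y∈Y =
      K⊨S _ ∃C⊑D (k + δ) _ _ (persists-role K r p xry) (derivable-sound derʸ (step rx xry y∈Y))

  -- Soundness holds up to a time shift, so a root derived at time i can be realised at any t.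
  local-root-entailed : ∀ {A r B C D i} → S (A ⊑∃[ local r ] B) → Derivable B i [] C i →
                        S (∃[ local r ] C ⊑ D) → S ⊨ (A ⊑○[ 0ℤ ] D)
  local-root-entailed {B = B} {C} {D} {i} A⊑∃B der ∃C⊑D K K⊨S t x x∈A
    with K⊨S _ A⊑∃B t x x∈A
  ... | y , xry , y∈B =
    subst (λ s → conc K D s x) (sym (+-identityʳ t)) (K⊨S _ ∃C⊑D t x y xry y∈C)
    where
      y∈C : conc K C t y
      y∈C = subst (λ s → conc K C s y) (\\-leftDividesˡ i t)
              (derivable-sound K K⊨S (- i + t) B i der
                (root (subst (λ s → conc K B s y) (sym (\\-leftDividesˡ i t)) y∈B)))

module CanonicalExtension (T : TBox) (I : Interp) (I⊨ : Model I (Tlinrig T)) where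
  open Chase ⟦ T ⟧

  -- An anonymous element: a root concept and time, and the path leading to it from the root.
  Anonymous : Set
  Anonymous = ConceptName × ℤ × List Step

  Edge : RoleName → ℤ → Anonymous → Anonymous → Set
  Edge r t a (B₁ , i₁ , []) = ⊥
  Edge r t (B₀ , i₀ , w) (B₁ , i₁ , step X r′ Y j ∷ w′) =
    ((B₁ , i₁ , w′) ≡ (B₀ , i₀ , w)) × (r′ ≡ r) × Derivable B₀ i₀ w X j ×
    ((X ⊑∃[ r ] Y) ∈ T) × Persists r j t

  Domain : Set
  Domain = Δ I ⊎ Anonymous

  concᴶ : ConceptName → ℤ → Domain → Set
  concᴶ C k (inj₁ d)             = conc I C k d
  concᴶ C k (inj₂ (B₀ , i₀ , w)) = Derivable B₀ i₀ w C k

  rigᴶ : ℕ → Domain → Domain → Set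
  rigᴶ r (inj₁ d) (inj₁ e) = rigᴵ I r d e
  rigᴶ r (inj₂ a) (inj₂ b) = Edge (rigid r) 0ℤ a b
  rigᴶ r _        _        = ⊥

  locᴶ : ℕ → ℤ → Domain → Domain → Set
  locᴶ r t (inj₁ d) (inj₂ (B , i , [])) =
    Σ ConceptName λ A → ((A ⊑∃[ local r ] B) ∈ T) × conc I A t d × (i ≡ t)
  locᴶ r t (inj₂ a) (inj₂ b) = Edge (local r) t a b
  locᴶ r t _        _        = ⊥

  J : Interp
  J = record { Δ = Domain ; point = inj₁ (point I) ; conc = concᴶ ; rigᴵ = rigᴶ ; locᴵ = locᴶ }

  I⊨T₀ : ∀ {α} → α ∈ T → (UsesLocal α → ⊥) → I ⊨ᶜ α
  I⊨T₀ α∈T nonlocal = I⊨ _ (inj₁ (lift (α∈T , nonlocal)))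

  J⊨T : Model J ⟦ T ⟧
  J⊨T (A ⊑○[ m ] B) ax i (inj₁ d) d∈A = I⊨T₀ ax (λ ()) i d d∈A
  J⊨T (A ⊑○[ m ] B) ax i (inj₂ _) der = next der ax
  J⊨T (∃[ rigid r ] C ⊑ D) ax i (inj₁ d) (inj₁ e) dre e∈C = I⊨T₀ ax (λ ()) i d e dre e∈C
  J⊨T (∃[ rigid r ] C ⊑ D) ax i (inj₂ _) (inj₂ (_ , _ , step _ _ _ _ ∷ _))
      (refl , refl , der , X⊑∃Y , p) derᶜ = backward der X⊑∃Y derᶜ ax p
  J⊨T (∃[ local r ] C ⊑ D) ax i (inj₁ d) (inj₂ (_ , _ , [])) (A , A⊑∃B , d∈A , refl) derᶜ =
    subst (λ s → conc I D s d) (+-identityʳ i)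
      (I⊨ _ (inj₂ (A , D , refl , local-root-entailed A⊑∃B derᶜ ax)) i d d∈A)
  J⊨T (∃[ local r ] C ⊑ D) ax i (inj₂ _) (inj₂ (_ , _ , step _ _ _ _ ∷ _))
      (refl , refl , der , X⊑∃Y , p) derᶜ = backward der X⊑∃Y derᶜ ax p
  J⊨T (A ⊑∃[ rigid r ] B) ax i (inj₁ d) d∈A with I⊨T₀ ax (λ ()) i d d∈A
  ... | e , dre , e∈B = inj₁ e , dre , e∈B
  J⊨T (A ⊑∃[ local r ] B) ax i (inj₁ d) d∈A = inj₂ (B , i , []) , (A , ax , d∈A , refl) , root
  J⊨T (A ⊑∃[ rigid r ] B) ax i (inj₂ (B₀ , i₀ , w)) der =
    inj₂ (B₀ , i₀ , step A (rigid r) B i ∷ w) , (refl , refl , der , ax , tt) , witness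
  J⊨T (A ⊑∃[ local r ] B) ax i (inj₂ (B₀ , i₀ , w)) der =
    inj₂ (B₀ , i₀ , step A (local r) B i ∷ w) , (refl , refl , der , ax , refl) , witness

  I↪J : ConceptEmbedding I J
  I↪J = record { embed = inj₁ ; preserve = λ d∈C → d∈C ; reflect = λ d∈C → d∈C }

Model-Tlinrig⇒extension : (T : TBox) (I : Interp) → Model I (Tlinrig T) →
                          Σ Interp λ J → Model J ⟦ T ⟧ × ConceptEmbedding I J
Model-Tlinrig⇒extension T I I⊨ = J , J⊨T , I↪J
  where open CanonicalExtension T I I⊨

lemma5 : (T : TBox) (A B : ConceptName) (n : ℤ) →
    OccursIn A T → OccursIn B T →
    (⟦ T ⟧ ⊨ (A ⊑○[ n ] B)) ⇔ (Tlinrig T ⊨ (A ⊑○[ n ] B))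
lemma5 T A B n _ _ =
  mk⇔ (⊨○-reflect (Model-Tlinrig⇒extension T))
      (⊨-antitone {α = A ⊑○[ n ] B} (Model⇒Model-Tlinrig T))
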